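{- Let $n \ge 1$ and $N \ge 1$ be integers and $R$ a ring. (a) If $n!N$ is not a zero divisor in $R$, then $V_n(R)^{\Gamma(N)} = 0$. (b) If $n!N$ is invertible in $R$, then $V_n(R)_{\Gamma(N)} = 0$. (c) Let $p$ be a prime and $\Gamma \le \mathrm{SL}_2(\mathbb{Z})$ a subgroup such that reduction modulo $p$ defines a surjection $\Gamma \twoheadrightarrow \mathrm{SL}_2(\mathbb{F}_p)$. Suppose $1 \le n \le p$ if $p>2$, and $n = 1$ if $p = 2$. Then $V_n(\mathbb{F}_p)^\Gamma = 0 = V_n(\mathbb{F}_p)_\Gamma$.
   Context: $V_n(R) = \mathrm{Sym}^n(R^2) \cong R[X,Y]_n$ (homogeneous polynomials of degree $n$) with left action $(M.P)(X,Y) = P(aX+cY, bX+dY)$ for $M=\begin{pmatrix}a&b\\c&d\end{pmatrix}$. $\Gamma(N)$ is the principal congruence subgroup of level $N$. Superscripts denote invariants and subscripts coinvariants. -}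

module Defs where

open import Level using (Level; 0ℓ; _⊔_)
open import Data.Nat as ℕ using (ℕ; zero; suc; _∸_)
open import Data.Fin using (Fin; toℕ)
import Data.Fin as Fin
open import Data.Integer as ℤ using (ℤ; +_; -[1+_])
open import Data.Integer.Divisibility as ℤDiv using ()
open import Data.Product using (Σ; _×_; ∃)
open import Relation.Binary.PropositionalEquality using (_≡_)
open import Algebra.Bundles using (CommutativeRing)
open import Algebra.Bundles.Raw using (RawRing)

record Mat2 : Set where
  constructor mat
  field
    a b c d : ℤ

open Mat2 public

det : Mat2 → ℤ
det M = (a M ℤ.* d M) ℤ.- (b M ℤ.* c M)

I₂ : Mat2
I₂ = mat (+ 1) (+ 0) (+ 0) (+ 1)

_·_ : Mat2 → Mat2 → Mat2
M · M' = mat (a M ℤ.* a M' ℤ.+ b M ℤ.* c M') (a M ℤ.* b M' ℤ.+ b M ℤ.* d M')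
             (c M ℤ.* a M' ℤ.+ d M ℤ.* c M') (c M ℤ.* b M' ℤ.+ d M ℤ.* d M')

-- inverse of a determinant-one matrix
inv : Mat2 → Mat2
inv M = mat (d M) (ℤ.- b M) (ℤ.- c M) (a M)

record IsSubgroupSL2 (Γ : Mat2 → Set) : Set where
  field
    ⊆SL2  : ∀ M → Γ M → det M ≡ + 1
    id∈   : Γ I₂
    ·∈    : ∀ M M' → Γ M → Γ M' → Γ (M · M')
    inv∈  : ∀ M → Γ M → Γ (inv M)

Γ[_] : ℕ → Mat2 → Set
Γ[ N ] M = (det M ≡ + 1)
         × ((+ N) ℤDiv.∣ (a M ℤ.- + 1)) × ((+ N) ℤDiv.∣ b M)
         × ((+ N) ℤDiv.∣ c M) × ((+ N) ℤDiv.∣ (d M ℤ.- + 1))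

module _ {c₀ ℓ : Level} (R : RawRing c₀ ℓ) where
  open RawRing R

  fromℕ : ℕ → Carrier
  fromℕ zero    = 0#
  fromℕ (suc k) = 1# + fromℕ k

  fromℤ : ℤ → Carrier
  fromℤ (+ k)     = fromℕ k
  fromℤ -[1+ k ]  = - fromℕ (suc k)

  sumTo : ℕ → (ℕ → Carrier) → Carrier
  sumTo zero    f = 0#
  sumTo (suc m) f = sumTo m f + f m

  sumFin : ∀ {m} → (Fin m → Carrier) → Carrier
  sumFin {zero}  f = 0#
  sumFin {suc m} f = f Fin.zero + sumFin (λ i → f (Fin.suc i))

  -- A homogeneous polynomial of degree k in X,Y is recorded by the
  -- sequence i ↦ coefficient of X^i Y^(k-i) (zero for i > k).
  -- Product of homogeneous polynomials = convolution of these sequences.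
  _⊛_ : (ℕ → Carrier) → (ℕ → Carrier) → (ℕ → Carrier)
  (f ⊛ g) i = sumTo (suc i) (λ j → f j * g (i ∸ j))

  one : ℕ → Carrier
  one zero    = 1#
  one (suc _) = 0#

  -- the linear form  u X + v Y
  lin : Carrier → Carrier → (ℕ → Carrier)
  lin u v zero          = v
  lin u v (suc zero)    = u
  lin u v (suc (suc _)) = 0#

  pow : (ℕ → Carrier) → ℕ → (ℕ → Carrier)
  pow f zero    = one
  pow f (suc k) = f ⊛ pow f k

  -- V_n(R): P = Σ_{k ≤ n} P k · X^k Y^(n-k)
  V : ℕ → Set c₀
  V n = Fin (suc n) → Carrier

  -- (M.P)(X,Y) = P(aX+cY, bX+dY) = Σ_k P k (aX+cY)^k (bX+dY)^(n-k)
  act : ∀ {n} → Mat2 → V n → V n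
  act {n} M P j =
    sumFin (λ k → P k *
      ((pow (lin (fromℤ (a M)) (fromℤ (c M))) (toℕ k)
        ⊛ pow (lin (fromℤ (b M)) (fromℤ (d M))) (n ∸ toℕ k)) (toℕ j)))

  _≈V_ : ∀ {n} → V n → V n → Set ℓ
  P ≈V Q = ∀ j → P j ≈ Q j

  0V : ∀ {n} → V n
  0V j = 0#

  _-V_ : ∀ {n} → V n → V n → V n
  (P -V Q) j = P j + (- Q j)

  _+V_ : ∀ {n} → V n → V n → V n
  (P +V Q) j = P j + Q j

  negV : ∀ {n} → V n → V n
  negV P j = - P j

  InvariantsVanish : ℕ → (Mat2 → Set) → Set (c₀ ⊔ ℓ)
  InvariantsVanish n Γ =
    (P : V n) → (∀ M → Γ M → act M P ≈V P) → P ≈V 0V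

  data InAug (n : ℕ) (Γ : Mat2 → Set) : V n → Set (c₀ ⊔ ℓ) where
    gen  : ∀ M (P : V n) → Γ M → InAug n Γ (act M P -V P)
    zer  : InAug n Γ 0V
    add  : ∀ {P Q} → InAug n Γ P → InAug n Γ Q → InAug n Γ (P +V Q)
    neg  : ∀ {P} → InAug n Γ P → InAug n Γ (negV P)
    resp : ∀ {P Q} → P ≈V Q → InAug n Γ P → InAug n Γ Q

  -- V_n(R)_Γ = V_n(R) / InAug = 0
  CoinvariantsVanish : ℕ → (Mat2 → Set) → Set (c₀ ⊔ ℓ)
  CoinvariantsVanish n Γ = (P : V n) → InAug n Γ P

  NotZeroDivisor : ℕ → Set (c₀ ⊔ ℓ)
  NotZeroDivisor m = ∀ r → (fromℕ m * r) ≈ 0# → r ≈ 0#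

  Invertible : ℕ → Set (c₀ ⊔ ℓ)
  Invertible m = Σ Carrier λ u → (fromℕ m * u) ≈ 1#

-- F_p, modelled as ℤ with equality "congruent mod p"

𝔽 : ℕ → RawRing 0ℓ 0ℓ
𝔽 p = record
  { Carrier = ℤ
  ; _≈_ = λ x y → (+ p) ℤDiv.∣ (x ℤ.- y)
  ; _+_ = ℤ._+_
  ; _*_ = ℤ._*_
  ; -_  = ℤ.-_
  ; 0#  = + 0
  ; 1#  = + 1
  }

_≡[mod_]_ : ℤ → ℕ → ℤ → Set
x ≡[mod p ] y = (+ p) ℤDiv.∣ (x ℤ.- y)

ReductionSurjective : ℕ → (Mat2 → Set) → Set
ReductionSurjective p Γ =
  ∀ (α β γ δ : ℤ) → ((α ℤ.* δ) ℤ.- (β ℤ.* γ)) ≡[mod p ] (+ 1) →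
  Σ Mat2 λ M → Γ M × (a M ≡[mod p ] α) × (b M ≡[mod p ] β)
                   × (c M ≡[mod p ] γ) × (d M ≡[mod p ] δ)

{-# OPTIONS --safe #-}
-- Record P ∈ V_n(R) by its coefficients P_k at X^k Y^(n-k).  The unipotent
-- [[1,t],[0,1]] acts unitriangularly on this basis, the image of X^k Y^(n-k)
-- having coefficient (n-k)t at X^(k+1) Y^(n-k-1); [[1,0],[s,1]] sends X^n to
-- X^n + n s X^(n-1) Y + ⋯.  So a vector fixed by both satisfies (n-k) t P_k = 0
-- for k < n, inductively from k = 0, and n s P_n = 0.  Dually, if these scalars
-- are units, subtracting suitable generators g(q e_k) - q e_k of the
-- augmentation submodule clears the coefficients of any vector one at a time:
-- that of Y^n with g lower unipotent (k = 1), the others with g upper unipotent.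
-- Γ(N) contains both matrices with t = s = N, and m N divides n! N for m ≤ n.
-- Over F_p the lifts with t = s = 1 work for n < p; for n = p odd a lift of -I
-- acts as (-1)^p = -1, and 2 is invertible.
module Submission where

open import Defs
open import Level using (Level; 0ℓ; _⊔_)
open import Data.Nat as ℕ using (ℕ; zero; suc; _∸_; _≤_; _<_; _!; z≤n; s≤s)
import Data.Nat.Properties as ℕ
open import Data.Nat.Divisibility using (_∣_; divides; _∣0; ∣-refl; ∣-trans; m∣m*n; n∣m*n; *-monoˡ-∣; m≤n⇒m!∣n!)
open import Data.Nat.DivMod using (_%_; _/_; m%n<n; m≡m%n+[m/n]*n)
open import Data.Nat.Primality using (Prime; prime⇒irreducible; prime⇒nonTrivial)
open import Data.Nat.Coprimality using (prime⇒coprime; coprime-Bézout)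
open import Data.Nat.GCD using (module Bézout)
open import Data.Fin as Fin using (Fin; toℕ)
import Data.Fin.Properties as Fin
open import Data.Product using (Σ; _×_; _,_)
open import Data.Sum as Sum using (_⊎_; inj₁; inj₂)
open import Data.Empty using (⊥-elim)
open import Function using (_∘_)
open import Relation.Nullary using (yes; no)
open import Relation.Binary.PropositionalEquality as ≡ using (_≡_; _≢_)
open import Relation.Binary.Definitions using (tri<; tri≈; tri>)
open import Algebra.Bundles using (CommutativeRing)
open import Algebra.Structures using (IsCommutativeRing)
open import Data.Integer as ℤ using (ℤ; +_; -[1+_])
import Data.Integer.Properties as ℤ
import Data.Integer.Divisibility.Signed as S
open import Data.Integer.Solver using (module +-*-Solver)

module _ {r ℓ} (R : CommutativeRing r ℓ) where
  open CommutativeRing R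
  open import Algebra.Definitions _≈_ using (RightInvertible)
  open import Algebra.Properties.Ring ring using (-1*x≈-x; -‿distribˡ-*; -‿distribʳ-*; [y-z]x≈yx-zx)
  open import Algebra.Properties.Group +-group using (⁻¹-involutive; identityˡ-unique; x≈y⇒x∙y⁻¹≈ε; ε⁻¹≈ε)
  open import Algebra.Properties.AbelianGroup +-abelianGroup using (⁻¹-∙-comm)
  open import Algebra.Properties.Semiring.Exp semiring using (_^_; ^-homo-*)
  open import Algebra.Properties.Semiring.Mult semiring as Mult using (×1-homo-*)
  open import Relation.Binary.Reasoning.Setoid setoid

  private variable
    m n k : ℕ
    x y u u′ v v′ w z : Carrier
    f f′ g g′ : ℕ → Carrier

  x≈0⇒x*y≈0 : x ≈ 0# → ∀ y → x * y ≈ 0#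
  x≈0⇒x*y≈0 x≈0 y = trans (*-congʳ x≈0) (zeroˡ y)

  y≈0⇒x*y≈0 : ∀ x → y ≈ 0# → x * y ≈ 0#
  y≈0⇒x*y≈0 x y≈0 = trans (*-congˡ y≈0) (zeroʳ x)

  [x*w]*z≈x : z * w ≈ 1# → (x * w) * z ≈ x
  [x*w]*z≈x {z} {w} {x} zw≈1 = begin
    (x * w) * z  ≈⟨ *-assoc x w z ⟩
    x * (w * z)  ≈⟨ *-congˡ (trans (*-comm w z) zw≈1) ⟩
    x * 1#       ≈⟨ *-identityʳ x ⟩
    x            ∎

  Cancellable : Carrier → Set (r ⊔ ℓ)
  Cancellable x = ∀ y → x * y ≈ 0# → y ≈ 0#

  Unit : Carrier → Set (r ⊔ ℓ)
  Unit = RightInvertible 1# _*_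

  Unit⇒Cancellable : Unit x → Cancellable x
  Unit⇒Cancellable {x} (x⁻¹ , xx⁻¹≈1) y xy≈0 = begin
    y                ≈⟨ *-identityˡ y ⟨
    1# * y           ≈⟨ *-congʳ (trans (*-comm x⁻¹ x) xx⁻¹≈1) ⟨
    (x⁻¹ * x) * y    ≈⟨ *-assoc x⁻¹ x y ⟩
    x⁻¹ * (x * y)    ≈⟨ *-congˡ xy≈0 ⟩
    x⁻¹ * 0#         ≈⟨ zeroʳ x⁻¹ ⟩
    0#               ∎

  Unit-resp-≈ : x ≈ y → Unit x → Unit y
  Unit-resp-≈ x≈y (x⁻¹ , xx⁻¹≈1) = x⁻¹ , trans (*-congʳ (sym x≈y)) xx⁻¹≈1

  Cancellable-resp-≈ : x ≈ y → Cancellable x → Cancellable y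
  Cancellable-resp-≈ x≈y cancel z yz≈0 = cancel z (trans (*-congʳ x≈y) yz≈0)

  Unit-factorʳ : Unit (x * y) → Unit y
  Unit-factorʳ {x} {y} (w , xyw≈1) = x * w , (begin
    y * (x * w)  ≈⟨ *-assoc y x w ⟨
    (y * x) * w  ≈⟨ *-congʳ (*-comm y x) ⟩
    (x * y) * w  ≈⟨ xyw≈1 ⟩
    1#           ∎)

  Cancellable-factorʳ : Cancellable (x * y) → Cancellable y
  Cancellable-factorʳ {x} {y} cancel z yz≈0 = cancel z (trans (*-assoc x y z) (y≈0⇒x*y≈0 x yz≈0))

  Unit-neg : Unit x → Unit (- x)
  Unit-neg {x} (x⁻¹ , xx⁻¹≈1) = - x⁻¹ , (begin
    - x * - x⁻¹    ≈⟨ -‿distribˡ-* x (- x⁻¹) ⟨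
    - (x * - x⁻¹)  ≈⟨ -‿cong (-‿distribʳ-* x x⁻¹) ⟨
    - - (x * x⁻¹)  ≈⟨ ⁻¹-involutive (x * x⁻¹) ⟩
    x * x⁻¹        ≈⟨ xx⁻¹≈1 ⟩
    1#             ∎)

  ι : ℕ → Carrier
  ι = fromℕ rawRing

  ι≈×1 : ∀ m → ι m ≈ m Mult.× 1#
  ι≈×1 zero    = refl
  ι≈×1 (suc m) = +-congˡ (ι≈×1 m)

  ι-* : ∀ m n → ι (m ℕ.* n) ≈ ι m * ι n
  ι-* m n = begin
    ι (m ℕ.* n)          ≈⟨ ι≈×1 (m ℕ.* n) ⟩
    (m ℕ.* n) Mult.× 1#  ≈⟨ ×1-homo-* m n ⟩
    (m Mult.× 1#) * (n Mult.× 1#) ≈⟨ *-cong (ι≈×1 m) (ι≈×1 n) ⟨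
    ι m * ι n            ∎

  Cancellable-ι-∣ : m ∣ k → Cancellable (ι k) → Cancellable (ι m)
  Cancellable-ι-∣ {m} (divides q ≡.refl) = Cancellable-factorʳ ∘ Cancellable-resp-≈ (ι-* q m)

  Unit-ι-∣ : m ∣ k → Unit (ι k) → Unit (ι m)
  Unit-ι-∣ {m} (divides q ≡.refl) = Unit-factorʳ ∘ Unit-resp-≈ (ι-* q m)

  ι-suc-* : ∀ m x → ι (suc m) * x ≈ x + ι m * x
  ι-suc-* m x = trans (distribʳ x 1# (ι m)) (+-congʳ (*-identityˡ x))

  1^n≈1 : ∀ n → 1# ^ n ≈ 1#
  1^n≈1 zero    = refl
  1^n≈1 (suc n) = trans (*-identityˡ (1# ^ n)) (1^n≈1 n)

  -1^even : ∀ q → (- 1#) ^ (q ℕ.* 2) ≈ 1#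
  -1^even zero    = refl
  -1^even (suc q) = begin
    - 1# * (- 1# * (- 1#) ^ (q ℕ.* 2))  ≈⟨ *-assoc (- 1#) (- 1#) _ ⟨
    (- 1# * - 1#) * (- 1#) ^ (q ℕ.* 2)  ≈⟨ *-cong (trans (-1*x≈-x (- 1#)) (⁻¹-involutive 1#)) (-1^even q) ⟩
    1# * 1#                             ≈⟨ *-identityˡ 1# ⟩
    1#                                  ∎

  -1^odd : ∀ q → (- 1#) ^ suc (q ℕ.* 2) ≈ - 1#
  -1^odd q = trans (*-congˡ (-1^even q)) (*-identityʳ (- 1#))

  Unit-[-1]^odd-1 : ∀ q → Unit (1# + 1#) → Unit ((- 1#) ^ suc (q ℕ.* 2) - 1#)
  Unit-[-1]^odd-1 q = Unit-resp-≈ (sym (trans (+-congʳ (-1^odd q)) (⁻¹-∙-comm 1# 1#))) ∘ Unit-neg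

  -- Sums and powers of linear forms

  sum< : ℕ → (ℕ → Carrier) → Carrier
  sum< = sumTo rawRing

  sum<-cong : ∀ m → (∀ i → f i ≈ g i) → sum< m f ≈ sum< m g
  sum<-cong zero    f≈g = refl
  sum<-cong (suc m) f≈g = +-cong (sum<-cong m f≈g) (f≈g m)

  sum<-zero : ∀ m → (∀ i → i < m → f i ≈ 0#) → sum< m f ≈ 0#
  sum<-zero zero    f≈0 = refl
  sum<-zero (suc m) f≈0 =
    trans (+-cong (sum<-zero m (λ i i<m → f≈0 i (ℕ.m<n⇒m<1+n i<m))) (f≈0 m ℕ.≤-refl))
          (+-identityʳ 0#)

  sum<-uncons : ∀ m f → sum< (suc m) f ≈ f 0 + sum< m (f ∘ suc)
  sum<-uncons zero    f = trans (+-identityˡ (f 0)) (sym (+-identityʳ (f 0)))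
  sum<-uncons (suc m) f = trans (+-congʳ (sum<-uncons m f)) (+-assoc _ _ _)

  sum<-δ : ∀ m → k < m → (∀ i → i < m → i ≢ k → f i ≈ 0#) → sum< m f ≈ f k
  sum<-δ {k} (suc m) k<1+m f≈0 with k ℕ.≟ m
  ... | yes ≡.refl =
    trans (+-congʳ (sum<-zero m (λ i i<m → f≈0 i (ℕ.m<n⇒m<1+n i<m) (ℕ.<⇒≢ i<m))))
          (+-identityˡ _)
  ... | no k≢m =
    trans (+-cong (sum<-δ m (ℕ.≤∧≢⇒< (ℕ.s≤s⁻¹ k<1+m) k≢m) (λ i i<m → f≈0 i (ℕ.m<n⇒m<1+n i<m)))
                  (f≈0 m ℕ.≤-refl (k≢m ∘ ≡.sym)))
          (+-identityʳ _)

  sumᶠ : (Fin n → Carrier) → Carrier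
  sumᶠ = sumFin rawRing

  sumᶠ-cong : {h h′ : Fin n → Carrier} → (∀ i → h i ≈ h′ i) → sumᶠ h ≈ sumᶠ h′
  sumᶠ-cong {zero}  h≈h′ = refl
  sumᶠ-cong {suc n} h≈h′ = +-cong (h≈h′ Fin.zero) (sumᶠ-cong (h≈h′ ∘ Fin.suc))

  sumᶠ-zero : (h : Fin n → Carrier) → (∀ i → h i ≈ 0#) → sumᶠ h ≈ 0#
  sumᶠ-zero {zero}  h h≈0 = refl
  sumᶠ-zero {suc n} h h≈0 = trans (+-cong (h≈0 Fin.zero) (sumᶠ-zero (h ∘ Fin.suc) (h≈0 ∘ Fin.suc)))
                                  (+-identityʳ 0#)

  sumᶠ-δ : (i : Fin n) (h : Fin n → Carrier) → (∀ l → l ≢ i → h l ≈ 0#) → sumᶠ h ≈ h i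
  sumᶠ-δ Fin.zero    h h≈0 =
    trans (+-congˡ (sumᶠ-zero (h ∘ Fin.suc) (λ l → h≈0 (Fin.suc l) λ ())))
          (+-identityʳ _)
  sumᶠ-δ (Fin.suc i) h h≈0 =
    trans (+-cong (h≈0 Fin.zero λ ())
                  (sumᶠ-δ i (h ∘ Fin.suc) (λ l l≢i → h≈0 (Fin.suc l) (l≢i ∘ Fin.suc-injective))))
          (+-identityˡ _)

  sumᶠ-pair : (i j : Fin n) (h : Fin n → Carrier) → i ≢ j → (∀ l → l ≢ i → l ≢ j → h l ≈ 0#) →
              sumᶠ h ≈ h i + h j
  sumᶠ-pair Fin.zero Fin.zero h i≢j h≈0 = ⊥-elim (i≢j ≡.refl)
  sumᶠ-pair Fin.zero (Fin.suc j) h i≢j h≈0 =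
    +-congˡ (sumᶠ-δ j (h ∘ Fin.suc) (λ l l≢j → h≈0 (Fin.suc l) (λ ()) (l≢j ∘ Fin.suc-injective)))
  sumᶠ-pair (Fin.suc i) Fin.zero h i≢j h≈0 =
    trans (+-congˡ (sumᶠ-δ i (h ∘ Fin.suc) (λ l l≢i → h≈0 (Fin.suc l) (l≢i ∘ Fin.suc-injective) (λ ()))))
          (+-comm _ _)
  sumᶠ-pair (Fin.suc i) (Fin.suc j) h i≢j h≈0 =
    trans (+-cong (h≈0 Fin.zero (λ ()) (λ ()))
                  (sumᶠ-pair i j (h ∘ Fin.suc) (i≢j ∘ ≡.cong Fin.suc)
                    (λ l l≢i l≢j → h≈0 (Fin.suc l) (l≢i ∘ Fin.suc-injective) (l≢j ∘ Fin.suc-injective))))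
          (+-identityˡ _)

  _⊛ᴿ_ : (ℕ → Carrier) → (ℕ → Carrier) → ℕ → Carrier
  _⊛ᴿ_ = _⊛_ rawRing

  ⊛-cong : (∀ i → f i ≈ f′ i) → (∀ i → g i ≈ g′ i) → ∀ j → (f ⊛ᴿ g) j ≈ (f′ ⊛ᴿ g′) j
  ⊛-cong f≈f′ g≈g′ j = sum<-cong (suc j) (λ l → *-cong (f≈f′ l) (g≈g′ (j ∸ l)))

  lin-⊛-suc : ∀ u v g i → (lin rawRing u v ⊛ᴿ g) (suc i) ≈ v * g (suc i) + u * g i
  lin-⊛-suc u v g i = begin
    sum< (suc (suc i)) F                 ≈⟨ sum<-uncons (suc i) F ⟩
    F 0 + sum< (suc i) (F ∘ suc)         ≈⟨ +-congˡ (sum<-uncons i (F ∘ suc)) ⟩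
    F 0 + (F 1 + sum< i (F ∘ suc ∘ suc)) ≈⟨ +-congˡ (+-congˡ (sum<-zero i (λ l _ → zeroˡ _))) ⟩
    F 0 + (F 1 + 0#)                     ≈⟨ +-congˡ (+-identityʳ (F 1)) ⟩
    v * g (suc i) + u * g i              ∎
    where
    F : ℕ → Carrier
    F l = lin rawRing u v l * g (suc i ∸ l)

  linPow : Carrier → Carrier → ℕ → ℕ → Carrier
  linPow u v = pow rawRing (lin rawRing u v)

  linPow-cong : u ≈ u′ → v ≈ v′ → ∀ m i → linPow u v m i ≈ linPow u′ v′ m i
  linPow-cong u≈u′ v≈v′ zero    i = refl
  linPow-cong u≈u′ v≈v′ (suc m) i = ⊛-cong lin≈ (linPow-cong u≈u′ v≈v′ m) i
    where
    lin≈ : ∀ l → lin rawRing _ _ l ≈ lin rawRing _ _ l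
    lin≈ zero          = v≈v′
    lin≈ (suc zero)    = u≈u′
    lin≈ (suc (suc l)) = refl

  linPow-zero : ∀ m → linPow u v m 0 ≈ v ^ m
  linPow-zero zero    = refl
  linPow-zero (suc m) = trans (+-identityˡ _) (*-congˡ (linPow-zero m))

  linPow-beyond : ∀ {j} → m < j → linPow u v m j ≈ 0#
  linPow-beyond {zero} {j = suc j} _ = refl
  linPow-beyond {suc m} {u} {v} {suc j} (s≤s m<j) =
    trans (lin-⊛-suc u v (linPow u v m) j)
          (trans (+-cong (y≈0⇒x*y≈0 v (linPow-beyond (ℕ.m<n⇒m<1+n m<j))) (y≈0⇒x*y≈0 u (linPow-beyond m<j)))
                 (+-identityʳ 0#))

  linPow-top : ∀ m → linPow u v m m ≈ u ^ m
  linPow-top zero = refl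
  linPow-top {u} {v} (suc m) =
    trans (lin-⊛-suc u v (linPow u v m) m)
          (trans (+-cong (y≈0⇒x*y≈0 v (linPow-beyond (ℕ.n<1+n m))) (*-congˡ (linPow-top m)))
                 (+-identityˡ _))

  linPow-one : ∀ m → linPow u 1# m 1 ≈ ι m * u
  linPow-one {u} zero    = sym (zeroˡ u)
  linPow-one {u} (suc m) = begin
    linPow u 1# (suc m) 1                          ≈⟨ lin-⊛-suc u 1# (linPow u 1# m) 0 ⟩
    1# * linPow u 1# m 1 + u * linPow u 1# m 0     ≈⟨ +-cong (*-identityˡ _) (*-congˡ (linPow-zero m)) ⟩
    linPow u 1# m 1 + u * 1# ^ m                   ≈⟨ +-cong (linPow-one m) (trans (*-congˡ (1^n≈1 m)) (*-identityʳ u)) ⟩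
    ι m * u + u                                    ≈⟨ +-comm _ u ⟩
    u + ι m * u                                    ≈⟨ ι-suc-* m u ⟨
    ι (suc m) * u                                  ∎

  linPow-subtop : ∀ m → linPow 1# v (suc m) m ≈ ι (suc m) * v
  linPow-subtop {v} zero = begin
    0# + v * 1#       ≈⟨ +-identityˡ _ ⟩
    v * 1#            ≈⟨ *-identityʳ v ⟩
    v                 ≈⟨ +-identityʳ v ⟨
    v + 0#            ≈⟨ +-congˡ (zeroˡ v) ⟨
    v + ι 0 * v       ≈⟨ ι-suc-* 0 v ⟨
    ι 1 * v           ∎
  linPow-subtop {v} (suc m) = begin
    linPow 1# v (suc (suc m)) (suc m)                         ≈⟨ lin-⊛-suc 1# v (linPow 1# v (suc m)) m ⟩
    v * linPow 1# v (suc m) (suc m) + 1# * linPow 1# v (suc m) m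
      ≈⟨ +-cong (*-congˡ (trans (linPow-top (suc m)) (1^n≈1 (suc m)))) (*-identityˡ _) ⟩
    v * 1# + linPow 1# v (suc m) m                            ≈⟨ +-cong (*-identityʳ v) (linPow-subtop m) ⟩
    v + ι (suc m) * v                                         ≈⟨ ι-suc-* (suc m) v ⟨
    ι (suc (suc m)) * v                                       ∎

  linPow-X-off : ∀ k j → j ≢ k → linPow u 0# k j ≈ 0#
  linPow-X-off zero    zero    j≢k = ⊥-elim (j≢k ≡.refl)
  linPow-X-off zero    (suc j) j≢k = refl
  linPow-X-off (suc k) zero    j≢k = trans (+-identityˡ _) (zeroˡ _)
  linPow-X-off {u} (suc k) (suc j) j≢k =
    trans (lin-⊛-suc u 0# (linPow u 0# k) j)
          (trans (+-cong (zeroˡ _) (y≈0⇒x*y≈0 u (linPow-X-off k j (j≢k ∘ ≡.cong suc))))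
                 (+-identityˡ 0#))

  linPow-Y-pos : ∀ m j → linPow 0# v m (suc j) ≈ 0#
  linPow-Y-pos zero    j = refl
  linPow-Y-pos {v} (suc m) j =
    trans (lin-⊛-suc 0# v (linPow 0# v m) j)
          (trans (+-cong (y≈0⇒x*y≈0 v (linPow-Y-pos m j)) (zeroˡ _))
                 (+-identityʳ 0#))

  ⊛-below : ∀ f g → (∀ l → l ≢ k → f l ≈ 0#) → ∀ {j} → j < k → (f ⊛ᴿ g) j ≈ 0#
  ⊛-below f g f≈0 j<k = sum<-zero _ λ l l≤j →
    x≈0⇒x*y≈0 (f≈0 l (ℕ.<⇒≢ (ℕ.≤-<-trans (ℕ.s≤s⁻¹ l≤j) j<k))) _

  ⊛-shift : ∀ f g → (∀ l → l ≢ k → f l ≈ 0#) → ∀ {j} → k ≤ j → (f ⊛ᴿ g) j ≈ f k * g (j ∸ k)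
  ⊛-shift f g f≈0 k≤j = sum<-δ _ (s≤s k≤j) λ l _ l≢k → x≈0⇒x*y≈0 (f≈0 l l≢k) _

  ⊛-constʳ : ∀ f g → (∀ l → g (suc l) ≈ 0#) → ∀ j → (f ⊛ᴿ g) j ≈ f j * g 0
  ⊛-constʳ f g g₊≈0 j =
    trans (sum<-δ (suc j) ℕ.≤-refl λ l l≤j l≢j →
             y≈0⇒x*y≈0 (f l) (g≈0 (j ∸ l) (ℕ.m>n⇒m∸n≢0 (ℕ.≤∧≢⇒< (ℕ.s≤s⁻¹ l≤j) l≢j))))
          (*-congˡ (reflexive (≡.cong g (ℕ.n∸n≡0 j))))
    where
    g≈0 : ∀ i → i ≢ 0 → g i ≈ 0#
    g≈0 zero    i≢0 = ⊥-elim (i≢0 ≡.refl)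
    g≈0 (suc i) _   = g₊≈0 i

  -- Matrices over R and their action on V_n(R)

  record Mat2ᴿ : Set r where
    constructor ⟦_,_,_,_⟧
    field a₁₁ a₁₂ a₂₁ a₂₂ : Carrier

  image : Mat2 → Mat2ᴿ
  image M = ⟦ fromℤ rawRing (a M) , fromℤ rawRing (b M) , fromℤ rawRing (c M) , fromℤ rawRing (d M) ⟧

  _≈ᴹ_ : Mat2ᴿ → Mat2ᴿ → Set ℓ
  ⟦ α , β , γ , δ ⟧ ≈ᴹ ⟦ α′ , β′ , γ′ , δ′ ⟧ = α ≈ α′ × β ≈ β′ × γ ≈ γ′ × δ ≈ δ′

  coeff : Mat2ᴿ → ℕ → ℕ → ℕ → Carrier
  coeff ⟦ α , β , γ , δ ⟧ n k = linPow α γ k ⊛ᴿ linPow β δ (n ∸ k)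

  -- act rawRing M is definitionally actᴿ (image M).
  actᴿ : Mat2ᴿ → V rawRing n → V rawRing n
  actᴿ {n} A P j = sumᶠ λ k → P k * coeff A n (toℕ k) (toℕ j)

  coeff-cong : ∀ {A B} → A ≈ᴹ B → ∀ n k j → coeff A n k j ≈ coeff B n k j
  coeff-cong (α≈ , β≈ , γ≈ , δ≈) n k =
    ⊛-cong (linPow-cong α≈ γ≈ k) (linPow-cong β≈ δ≈ (n ∸ k))

  actᴿ-cong : ∀ {A B} → A ≈ᴹ B → (P : V rawRing n) → _≈V_ rawRing (actᴿ A P) (actᴿ B P)
  actᴿ-cong {n} A≈B P j = sumᶠ-cong λ k → *-congˡ {P k} (coeff-cong A≈B n (toℕ k) (toℕ j))

  Contains : (Mat2 → Set) → Mat2ᴿ → Set ℓ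
  Contains Γ A = Σ Mat2 λ M → Γ M × image M ≈ᴹ A

  Fixed : Mat2ᴿ → V rawRing n → Set ℓ
  Fixed A P = _≈V_ rawRing (actᴿ A P) P

  Contains⇒Fixed : ∀ {Γ A} → Contains Γ A → (P : V rawRing n) →
                   (∀ M → Γ M → _≈V_ rawRing (act rawRing M P) P) → Fixed A P
  Contains⇒Fixed (M , M∈Γ , M≈A) P fixed j = trans (sym (actᴿ-cong M≈A P j)) (fixed M M∈Γ j)

  Contains⇒InAug : ∀ {Γ A} → Contains Γ A → (Q : V rawRing n) →
                   InAug rawRing n Γ (_-V_ rawRing (actᴿ A Q) Q)
  Contains⇒InAug (M , M∈Γ , M≈A) Q =
    resp (λ j → +-congʳ (actᴿ-cong M≈A Q j)) (gen M Q M∈Γ)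

  upper : Carrier → Mat2ᴿ
  upper t = ⟦ 1# , t , 0# , 1# ⟧

  lower : Carrier → Mat2ᴿ
  lower s = ⟦ 1# , 0# , s , 1# ⟧

  scalar : Carrier → Mat2ᴿ
  scalar μ = ⟦ μ , 0# , 0# , μ ⟧

  upper-coeff-below : ∀ t n {j} → j < k → coeff (upper t) n k j ≈ 0#
  upper-coeff-below {k} t n = ⊛-below (linPow 1# 0# k) (linPow t 1# (n ∸ k)) (linPow-X-off k)

  upper-coeff-shift : ∀ t n k {j} → k ≤ j → coeff (upper t) n k j ≈ linPow t 1# (n ∸ k) (j ∸ k)
  upper-coeff-shift t n k k≤j = begin
    coeff (upper t) n k _                          ≈⟨ ⊛-shift (linPow 1# 0# k) (linPow t 1# (n ∸ k)) (linPow-X-off k) k≤j ⟩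
    linPow 1# 0# k k * linPow t 1# (n ∸ k) (_ ∸ k)  ≈⟨ *-congʳ (trans (linPow-top k) (1^n≈1 k)) ⟩
    1# * linPow t 1# (n ∸ k) (_ ∸ k)                ≈⟨ *-identityˡ _ ⟩
    linPow t 1# (n ∸ k) (_ ∸ k)                     ∎

  upper-coeff-diag : ∀ t n k → coeff (upper t) n k k ≈ 1#
  upper-coeff-diag t n k = begin
    coeff (upper t) n k k           ≈⟨ upper-coeff-shift t n k ℕ.≤-refl ⟩
    linPow t 1# (n ∸ k) (k ∸ k)     ≈⟨ reflexive (≡.cong (linPow t 1# (n ∸ k)) (ℕ.n∸n≡0 k)) ⟩
    linPow t 1# (n ∸ k) 0           ≈⟨ linPow-zero (n ∸ k) ⟩
    1# ^ (n ∸ k)                    ≈⟨ 1^n≈1 (n ∸ k) ⟩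
    1#                              ∎

  upper-coeff-next : ∀ t n k → coeff (upper t) n k (suc k) ≈ ι (n ∸ k) * t
  upper-coeff-next t n k = begin
    coeff (upper t) n k (suc k)        ≈⟨ upper-coeff-shift t n k (ℕ.n≤1+n k) ⟩
    linPow t 1# (n ∸ k) (suc k ∸ k)    ≈⟨ reflexive (≡.cong (linPow t 1# (n ∸ k)) (ℕ.m+n∸n≡m 1 k)) ⟩
    linPow t 1# (n ∸ k) 1              ≈⟨ linPow-one (n ∸ k) ⟩
    ι (n ∸ k) * t                      ∎

  lower-coeff : ∀ s n k j → coeff (lower s) n k j ≈ linPow 1# s k j
  lower-coeff s n k j = begin
    coeff (lower s) n k j                          ≈⟨ ⊛-constʳ (linPow 1# s k) (linPow 0# 1# (n ∸ k)) (linPow-Y-pos (n ∸ k)) j ⟩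
    linPow 1# s k j * linPow 0# 1# (n ∸ k) 0       ≈⟨ *-congˡ (trans (linPow-zero (n ∸ k)) (1^n≈1 (n ∸ k))) ⟩
    linPow 1# s k j * 1#                           ≈⟨ *-identityʳ _ ⟩
    linPow 1# s k j                                ∎

  lower-coeff-prev : ∀ s n m → coeff (lower s) n (suc m) m ≈ ι (suc m) * s
  lower-coeff-prev s n m = trans (lower-coeff s n (suc m) m) (linPow-subtop m)

  scalar-coeff : ∀ μ n k j → coeff (scalar μ) n k j ≈ linPow μ 0# k j * μ ^ (n ∸ k)
  scalar-coeff μ n k j =
    trans (⊛-constʳ (linPow μ 0# k) (linPow 0# μ (n ∸ k)) (linPow-Y-pos (n ∸ k)) j) (*-congˡ (linPow-zero (n ∸ k)))

  scalar-coeff-off : ∀ μ n {j} → j ≢ k → coeff (scalar μ) n k j ≈ 0#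
  scalar-coeff-off {k} μ n {j} j≢k =
    trans (scalar-coeff μ n k j) (x≈0⇒x*y≈0 (linPow-X-off k j j≢k) _)

  scalar-coeff-diag : ∀ μ → k ≤ n → coeff (scalar μ) n k k ≈ μ ^ n
  scalar-coeff-diag {k} {n} μ k≤n = begin
    coeff (scalar μ) n k k            ≈⟨ scalar-coeff μ n k k ⟩
    linPow μ 0# k k * μ ^ (n ∸ k)     ≈⟨ *-congʳ (linPow-top k) ⟩
    μ ^ k * μ ^ (n ∸ k)               ≈⟨ ^-homo-* μ k (n ∸ k) ⟨
    μ ^ (k ℕ.+ (n ∸ k))               ≈⟨ reflexive (≡.cong (μ ^_) (ℕ.m+[n∸m]≡n k≤n)) ⟩
    μ ^ n                             ∎

  single : Fin (suc n) → Carrier → V rawRing n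
  single i x l with l Fin.≟ i
  ... | yes _ = x
  ... | no  _ = 0#

  single-≡ : ∀ (i : Fin (suc n)) x → single i x i ≈ x
  single-≡ i x with i Fin.≟ i
  ... | yes _   = refl
  ... | no  i≢i = ⊥-elim (i≢i ≡.refl)

  single-≢ : ∀ {i l : Fin (suc n)} x → l ≢ i → single i x l ≈ 0#
  single-≢ {i = i} {l} x l≢i with l Fin.≟ i
  ... | yes l≡i = ⊥-elim (l≢i l≡i)
  ... | no  _   = refl

  actᴿ-single : ∀ A (i : Fin (suc n)) x j → actᴿ A (single i x) j ≈ x * coeff A n (toℕ i) (toℕ j)
  actᴿ-single {n} A i x j =
    trans (sumᶠ-δ i (λ l → single i x l * coeff A n (toℕ l) (toℕ j))
                    (λ l l≢i → x≈0⇒x*y≈0 (single-≢ x l≢i) _))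
          (*-congʳ (single-≡ i x))

  actᴿ-scalar : ∀ μ (P : V rawRing n) j → actᴿ (scalar μ) P j ≈ μ ^ n * P j
  actᴿ-scalar {n} μ P j = begin
    actᴿ (scalar μ) P j                       ≈⟨ sumᶠ-δ j term term≈0 ⟩
    P j * coeff (scalar μ) n (toℕ j) (toℕ j)  ≈⟨ *-congˡ (scalar-coeff-diag μ (Fin.toℕ≤pred[n] j)) ⟩
    P j * μ ^ n                               ≈⟨ *-comm _ _ ⟩
    μ ^ n * P j                               ∎
    where
    term : Fin (suc n) → Carrier
    term l = P l * coeff (scalar μ) n (toℕ l) (toℕ j)
    term≈0 : ∀ l → l ≢ j → term l ≈ 0#
    term≈0 l l≢j = y≈0⇒x*y≈0 (P l) (scalar-coeff-off μ n (l≢j ∘ ≡.sym ∘ Fin.toℕ-injective))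

  -- Invariants and coinvariants under unipotent and scalar elements

  VanishesBelow : V rawRing n → ℕ → Set ℓ
  VanishesBelow P k = ∀ i → toℕ i < k → P i ≈ 0#

  VanishesBelow-suc : ∀ {P : V rawRing n} → VanishesBelow P k → (∀ i → toℕ i ≡ k → P i ≈ 0#) →
                      VanishesBelow P (suc k)
  VanishesBelow-suc below at-k i i<1+k with ℕ.m≤n⇒m<n∨m≡n (ℕ.s≤s⁻¹ i<1+k)
  ... | inj₁ i<k = below i i<k
  ... | inj₂ i≡k = at-k i i≡k

  actᴿ-upper-next : ∀ t {P : V rawRing n} → VanishesBelow P k → ∀ {i j} → toℕ i ≡ k → toℕ j ≡ suc k →
                    actᴿ (upper t) P j ≈ P i * (ι (n ∸ k) * t) + P j
  actᴿ-upper-next {n} {k} t {P} below {i} {j} i≡k j≡1+k = begin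
    actᴿ (upper t) P j                 ≈⟨ sumᶠ-pair i j term i≢j term≈0 ⟩
    P i * C (toℕ i) + P j * C (toℕ j)  ≈⟨ +-cong (*-congˡ Cᵢ≈kt) (*-congˡ (upper-coeff-diag t n (toℕ j))) ⟩
    P i * (ι (n ∸ k) * t) + P j * 1#   ≈⟨ +-congˡ (*-identityʳ (P j)) ⟩
    P i * (ι (n ∸ k) * t) + P j        ∎
    where
    C : ℕ → Carrier
    C k′ = coeff (upper t) n k′ (toℕ j)
    Cᵢ≈kt : C (toℕ i) ≈ ι (n ∸ k) * t
    Cᵢ≈kt = trans (reflexive (≡.cong₂ (coeff (upper t) n) i≡k j≡1+k)) (upper-coeff-next t n k)
    term : Fin (suc n) → Carrier
    term l = P l * C (toℕ l)
    i≢j : i ≢ j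
    i≢j i≡j = ℕ.1+n≢n (≡.trans (≡.sym j≡1+k) (≡.trans (≡.cong toℕ (≡.sym i≡j)) i≡k))
    term≈0 : ∀ l → l ≢ i → l ≢ j → term l ≈ 0#
    term≈0 l l≢i l≢j with ℕ.<-cmp (toℕ l) k
    ... | tri< l<k _ _ = x≈0⇒x*y≈0 (below l l<k) _
    ... | tri≈ _ l≡k _ = ⊥-elim (l≢i (Fin.toℕ-injective (≡.trans l≡k (≡.sym i≡k))))
    ... | tri> _ _ k<l = y≈0⇒x*y≈0 (P l) (upper-coeff-below t n j<l)
      where
      l≢1+k : suc k ≢ toℕ l
      l≢1+k 1+k≡l = l≢j (Fin.toℕ-injective (≡.trans (≡.sym 1+k≡l) (≡.sym j≡1+k)))
      j<l : toℕ j < toℕ l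
      j<l = ≡.subst (_< toℕ l) (≡.sym j≡1+k) (ℕ.≤∧≢⇒< k<l l≢1+k)

  upper-fixed-step : ∀ t {P : V rawRing n} → Fixed (upper t) P → k < n → Cancellable (ι (n ∸ k) * t) →
                     VanishesBelow P k → ∀ i → toℕ i ≡ k → P i ≈ 0#
  upper-fixed-step {n} {k} t {P} fixed k<n cancel below i i≡k = cancel (P i) (begin
    ι (n ∸ k) * t * P i    ≈⟨ *-comm _ (P i) ⟩
    P i * (ι (n ∸ k) * t)  ≈⟨ identityˡ-unique _ (P j) ≈Pj ⟩
    0#                     ∎)
    where
    j : Fin (suc n)
    j = Fin.fromℕ< (s≤s k<n)
    j≡1+k : toℕ j ≡ suc k
    j≡1+k = Fin.toℕ-fromℕ< (s≤s k<n)
    ≈Pj : P i * (ι (n ∸ k) * t) + P j ≈ P j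
    ≈Pj = trans (sym (actᴿ-upper-next t below i≡k j≡1+k)) (fixed j)

  lower-fixed-last : ∀ s {P : V rawRing (suc m)} → Fixed (lower s) P → Cancellable (ι (suc m) * s) →
                     VanishesBelow P (suc m) → ∀ i → toℕ i ≡ suc m → P i ≈ 0#
  lower-fixed-last {m} s {P} fixed cancel below i i≡1+m = cancel (P i) (begin
    ι (suc m) * s * P i                            ≈⟨ *-comm _ (P i) ⟩
    P i * (ι (suc m) * s)                          ≈⟨ *-congˡ Cᵢⱼ≈ms ⟨
    P i * coeff (lower s) (suc m) (toℕ i) (toℕ j)  ≈⟨ sumᶠ-δ i term term≈0 ⟨
    actᴿ (lower s) P j                             ≈⟨ fixed j ⟩
    P j                                            ≈⟨ below j (≡.subst (_< suc m) (≡.sym j≡m) (ℕ.n<1+n m)) ⟩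
    0#                                             ∎)
    where
    j : Fin (suc (suc m))
    j = Fin.fromℕ< (ℕ.m<n⇒m<1+n (ℕ.n<1+n m))
    j≡m : toℕ j ≡ m
    j≡m = Fin.toℕ-fromℕ< (ℕ.m<n⇒m<1+n (ℕ.n<1+n m))
    Cᵢⱼ≈ms : coeff (lower s) (suc m) (toℕ i) (toℕ j) ≈ ι (suc m) * s
    Cᵢⱼ≈ms = trans (reflexive (≡.cong₂ (coeff (lower s) (suc m)) i≡1+m j≡m)) (lower-coeff-prev s (suc m) m)
    term : Fin (suc (suc m)) → Carrier
    term l = P l * coeff (lower s) (suc m) (toℕ l) (toℕ j)
    term≈0 : ∀ l → l ≢ i → term l ≈ 0#
    term≈0 l l≢i = x≈0⇒x*y≈0 (below l (ℕ.≤∧≢⇒< (Fin.toℕ≤pred[n] l) l≢1+m)) _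
      where
      l≢1+m : toℕ l ≢ suc m
      l≢1+m l≡1+m = l≢i (Fin.toℕ-injective (≡.trans l≡1+m (≡.sym i≡1+m)))

  invariantsVanish-unipotent : ∀ {Γ} t s → 1 ≤ n → Contains Γ (upper t) → Contains Γ (lower s) →
                               (∀ m → 1 ≤ m → m ≤ n → Cancellable (ι m * t)) → Cancellable (ι n * s) →
                               InvariantsVanish rawRing n Γ
  invariantsVanish-unipotent {suc m} t s _ U L cancelU cancelL P fixed i =
    VanishesBelow-suc below-n (lower-fixed-last s (Contains⇒Fixed L P fixed) cancelL below-n) i (Fin.toℕ<n i)
    where
    below : ∀ k → k ≤ suc m → VanishesBelow P k
    below zero    _     l ()
    below (suc k) k<1+m = VanishesBelow-suc (below k (ℕ.<⇒≤ k<1+m))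
      (upper-fixed-step t (Contains⇒Fixed U P fixed) k<1+m
        (cancelU (suc m ∸ k) (ℕ.m<n⇒0<n∸m k<1+m) (ℕ.m∸n≤m (suc m) k)) (below k (ℕ.<⇒≤ k<1+m)))
    below-n : VanishesBelow P (suc m)
    below-n = below (suc m) ℕ.≤-refl

  InAug-difference : ∀ {Γ} {Q E : V rawRing n} → InAug rawRing n Γ E → InAug rawRing n Γ (_-V_ rawRing Q E) →
                     InAug rawRing n Γ Q
  InAug-difference {Q = Q} {E} E∈ Q-E∈ = resp (λ j → begin
    (Q j - E j) + E j    ≈⟨ +-assoc (Q j) (- E j) (E j) ⟩
    Q j + (- E j + E j)  ≈⟨ +-congˡ (-‿inverseˡ (E j)) ⟩
    Q j + 0#             ≈⟨ +-identityʳ (Q j) ⟩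
    Q j                  ∎) (add Q-E∈ E∈)

  VanishingBelowInAug : (Mat2 → Set) → ∀ n → ℕ → Set (r ⊔ ℓ)
  VanishingBelowInAug Γ n k = ∀ (Q : V rawRing n) → VanishesBelow Q k → InAug rawRing n Γ Q

  generator : Mat2ᴿ → Fin (suc n) → Carrier → V rawRing n
  generator A i q = _-V_ rawRing (actᴿ A (single i q)) (single i q)

  generator-upper-≤ : ∀ t (i : Fin (suc n)) q l → toℕ l ≤ toℕ i → generator (upper t) i q l ≈ 0#
  generator-upper-≤ {n} t i q l l≤i with ℕ.m≤n⇒m<n∨m≡n l≤i
  ... | inj₁ l<i = x≈y⇒x∙y⁻¹≈ε (begin
    actᴿ (upper t) (single i q) l          ≈⟨ actᴿ-single (upper t) i q l ⟩
    q * coeff (upper t) n (toℕ i) (toℕ l)  ≈⟨ y≈0⇒x*y≈0 q (upper-coeff-below t n l<i) ⟩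
    0#                                     ≈⟨ single-≢ q (λ l≡i → ℕ.<⇒≢ l<i (≡.cong toℕ l≡i)) ⟨
    single i q l                           ∎)
  ... | inj₂ l≡i with Fin.toℕ-injective l≡i
  ...   | ≡.refl = x≈y⇒x∙y⁻¹≈ε (begin
    actᴿ (upper t) (single i q) i          ≈⟨ actᴿ-single (upper t) i q i ⟩
    q * coeff (upper t) n (toℕ i) (toℕ i)  ≈⟨ *-congˡ (upper-coeff-diag t n (toℕ i)) ⟩
    q * 1#                                 ≈⟨ *-identityʳ q ⟩
    q                                      ≈⟨ single-≡ i q ⟨
    single i q i                           ∎)

  generator-upper-next : ∀ t (i : Fin (suc n)) q l → toℕ l ≡ suc (toℕ i) →
                         generator (upper t) i q l ≈ q * (ι (n ∸ toℕ i) * t)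
  generator-upper-next {n} t i q l l≡1+i = begin
    actᴿ (upper t) (single i q) l - single i q l      ≈⟨ +-cong (actᴿ-single (upper t) i q l) (-‿cong (single-≢ q l≢i)) ⟩
    q * coeff (upper t) n (toℕ i) (toℕ l) - 0#        ≈⟨ +-cong (*-congˡ (reflexive (≡.cong (coeff (upper t) n (toℕ i)) l≡1+i)))
                                                                ε⁻¹≈ε ⟩
    q * coeff (upper t) n (toℕ i) (suc (toℕ i)) + 0#  ≈⟨ +-identityʳ _ ⟩
    q * coeff (upper t) n (toℕ i) (suc (toℕ i))       ≈⟨ *-congˡ (upper-coeff-next t n (toℕ i)) ⟩
    q * (ι (n ∸ toℕ i) * t)                           ∎
    where
    l≢i : l ≢ i
    l≢i l≡i = ℕ.1+n≢n (≡.trans (≡.sym l≡1+i) (≡.cong toℕ l≡i))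

  generator-lower-zero : ∀ s q → generator {suc m} (lower s) (Fin.suc Fin.zero) q Fin.zero ≈ q * s
  generator-lower-zero {m} s q = begin
    actᴿ (lower s) (single i₁ q) Fin.zero - single i₁ q Fin.zero
      ≈⟨ +-cong (actᴿ-single (lower s) i₁ q Fin.zero) (-‿cong (single-≢ {i = i₁} {Fin.zero} q λ ())) ⟩
    q * coeff (lower s) (suc m) 1 0 - 0#  ≈⟨ +-cong (*-congˡ (lower-coeff-prev s (suc m) 0)) ε⁻¹≈ε ⟩
    q * (ι 1 * s) + 0#                    ≈⟨ +-identityʳ _ ⟩
    q * (ι 1 * s)                         ≈⟨ *-congˡ (trans (*-congʳ (+-identityʳ 1#)) (*-identityˡ s)) ⟩
    q * s                                 ∎
    where
    i₁ : Fin (suc (suc m))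
    i₁ = Fin.suc Fin.zero

  upper-aug-step : ∀ {Γ} t → Contains Γ (upper t) → k < n → Unit (ι (n ∸ k) * t) →
                   VanishingBelowInAug Γ n (suc (suc k)) → VanishingBelowInAug Γ n (suc k)
  upper-aug-step {k} {n} t U k<n (w , cw≈1) next Q below =
    InAug-difference (Contains⇒InAug U (single i q)) (next (_-V_ rawRing Q E) (VanishesBelow-suc below′ at-1+k))
    where
    i j : Fin (suc n)
    i = Fin.fromℕ< (ℕ.m<n⇒m<1+n k<n)
    j = Fin.fromℕ< (s≤s k<n)
    i≡k : toℕ i ≡ k
    i≡k = Fin.toℕ-fromℕ< (ℕ.m<n⇒m<1+n k<n)
    j≡1+k : toℕ j ≡ suc k
    j≡1+k = Fin.toℕ-fromℕ< (s≤s k<n)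
    q : Carrier
    q = Q j * w
    E : V rawRing n
    E = generator (upper t) i q
    below′ : VanishesBelow (_-V_ rawRing Q E) (suc k)
    below′ l l≤k = x≈y⇒x∙y⁻¹≈ε (trans (below l l≤k)
      (sym (generator-upper-≤ t i q l (≡.subst (toℕ l ≤_) (≡.sym i≡k) (ℕ.s≤s⁻¹ l≤k)))))
    at-1+k : ∀ l → toℕ l ≡ suc k → Q l - E l ≈ 0#
    at-1+k l l≡1+k with Fin.toℕ-injective (≡.trans l≡1+k (≡.sym j≡1+k))
    ... | ≡.refl = x≈y⇒x∙y⁻¹≈ε (sym (begin
      E j                          ≈⟨ generator-upper-next t i q j (≡.trans j≡1+k (≡.cong suc (≡.sym i≡k))) ⟩
      q * (ι (n ∸ toℕ i) * t)      ≈⟨ *-congˡ (reflexive (≡.cong (λ k′ → ι (n ∸ k′) * t) i≡k)) ⟩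
      Q j * w * (ι (n ∸ k) * t)    ≈⟨ [x*w]*z≈x cw≈1 ⟩
      Q j                          ∎))

  lower-aug-first : ∀ {Γ} s → Contains Γ (lower s) → Unit s → VanishingBelowInAug Γ (suc m) 1 →
                    CoinvariantsVanish rawRing (suc m) Γ
  lower-aug-first {m} s L (w , sw≈1) next Q =
    InAug-difference (Contains⇒InAug L (single (Fin.suc Fin.zero) q)) (next (_-V_ rawRing Q E) below)
    where
    q : Carrier
    q = Q Fin.zero * w
    E : V rawRing (suc m)
    E = generator (lower s) (Fin.suc Fin.zero) q
    below : VanishesBelow (_-V_ rawRing Q E) 1
    below Fin.zero    _ = x≈y⇒x∙y⁻¹≈ε (sym (trans (generator-lower-zero {m} s q) ([x*w]*z≈x sw≈1)))
    below (Fin.suc l) (s≤s ())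

  coinvariantsVanish-unipotent : ∀ {Γ} t s → 1 ≤ n → Contains Γ (upper t) → Contains Γ (lower s) →
                                 (∀ m → 1 ≤ m → m ≤ n → Unit (ι m * t)) → Unit s →
                                 CoinvariantsVanish rawRing n Γ
  coinvariantsVanish-unipotent {suc m} {Γ} t s _ U L unitU unitL =
    lower-aug-first s L unitL (spans (suc m) 0 (ℕ.+-identityʳ (suc m)))
    where
    spans : ∀ d k → d ℕ.+ k ≡ suc m → VanishingBelowInAug Γ (suc m) (suc k)
    spans zero    k ≡.refl Q below = resp (λ i → sym (below i (Fin.toℕ<n i))) zer
    spans (suc d) k d+k≡n =
      upper-aug-step t U k<n (unitU (suc m ∸ k) (ℕ.m<n⇒0<n∸m k<n) (ℕ.m∸n≤m (suc m) k))
                     (spans d (suc k) (≡.trans (ℕ.+-suc d k) d+k≡n))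
      where
      k<n : k < suc m
      k<n = ≡.subst (k <_) d+k≡n (ℕ.m<n+m k (s≤s z≤n))

  invariantsVanish-scalar : ∀ {Γ} μ → Contains Γ (scalar μ) → Cancellable (μ ^ n - 1#) →
                            InvariantsVanish rawRing n Γ
  invariantsVanish-scalar {n} μ S cancel P fixed j = cancel (P j) (begin
    (μ ^ n - 1#) * P j         ≈⟨ [y-z]x≈yx-zx (P j) (μ ^ n) 1# ⟩
    μ ^ n * P j - 1# * P j     ≈⟨ +-cong (sym (actᴿ-scalar μ P j)) (-‿cong (*-identityˡ (P j))) ⟩
    actᴿ (scalar μ) P j - P j  ≈⟨ x≈y⇒x∙y⁻¹≈ε (Contains⇒Fixed S P fixed j) ⟩
    0#                         ∎)

  coinvariantsVanish-scalar : ∀ {Γ} μ → Contains Γ (scalar μ) → Unit (μ ^ n - 1#) →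
                              CoinvariantsVanish rawRing n Γ
  coinvariantsVanish-scalar {n} μ S (w , cw≈1) Q = resp (λ j → begin
    actᴿ (scalar μ) wQ j - w * Q j        ≈⟨ +-cong (actᴿ-scalar μ wQ j) (-‿cong (sym (*-identityˡ _))) ⟩
    μ ^ n * (w * Q j) - 1# * (w * Q j)    ≈⟨ [y-z]x≈yx-zx (w * Q j) (μ ^ n) 1# ⟨
    (μ ^ n - 1#) * (w * Q j)              ≈⟨ *-assoc _ w (Q j) ⟨
    ((μ ^ n - 1#) * w) * Q j              ≈⟨ *-congʳ cw≈1 ⟩
    1# * Q j                              ≈⟨ *-identityˡ (Q j) ⟩
    Q j                                   ∎) (Contains⇒InAug S wQ)
    where
    wQ : V rawRing n
    wQ j = w * Q j

-- The ring ℤ/p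

module _ (p : ℕ) where
  open +-*-Solver using (solve; _:=_; _:+_; _:*_; _:-_; :-_; con)

  private
    toℤ : ∀ a b c d → 1 ℕ.+ a ℕ.* b ≡ c ℕ.* d → + 1 ℤ.+ + a ℤ.* + b ≡ + c ℤ.* + d
    toℤ a b c d eq = ≡.trans (≡.cong (ℤ._+_ (+ 1)) (≡.sym (ℤ.pos-* a b)))
                             (≡.trans (≡.cong +_ eq) (ℤ.pos-* c d))

    divides-by : ∀ x y {z} → z ≡ x ℤ.- y → (+ p) S.∣ z → x ≡[mod p ] y
    divides-by x y ≡.refl = S.∣⇒∣ᵤ

    signed : ∀ x y → x ≡[mod p ] y → (+ p) S.∣ (x ℤ.- y)
    signed x y = S.∣ᵤ⇒∣

  ≡[mod]-reflexive : ∀ {x y} → x ≡ y → x ≡[mod p ] y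
  ≡[mod]-reflexive {x} ≡.refl = divides-by x x (≡.sym (ℤ.+-inverseʳ x)) (S.divides (+ 0) ≡.refl)

  ≡[mod]-sym : ∀ {x y} → x ≡[mod p ] y → y ≡[mod p ] x
  ≡[mod]-sym {x} {y} x≡y = divides-by y x (solve 2 (λ x y → :- (x :- y) := y :- x) ≡.refl x y)
                                      (S.∣m⇒∣-m (signed x y x≡y))

  ≡[mod]-trans : ∀ {x y z} → x ≡[mod p ] y → y ≡[mod p ] z → x ≡[mod p ] z
  ≡[mod]-trans {x} {y} {z} x≡y y≡z =
    divides-by x z (solve 3 (λ x y z → (x :- y) :+ (y :- z) := x :- z) ≡.refl x y z)
               (S.∣m∣n⇒∣m+n (signed x y x≡y) (signed y z y≡z))

  +-cong-mod : ∀ {x y u v} → x ≡[mod p ] y → u ≡[mod p ] v → (x ℤ.+ u) ≡[mod p ] (y ℤ.+ v)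
  +-cong-mod {x} {y} {u} {v} x≡y u≡v =
    divides-by (x ℤ.+ u) (y ℤ.+ v)
      (solve 4 (λ x y u v → (x :- y) :+ (u :- v) := (x :+ u) :- (y :+ v)) ≡.refl x y u v)
      (S.∣m∣n⇒∣m+n (signed x y x≡y) (signed u v u≡v))

  *-cong-mod : ∀ {x y u v} → x ≡[mod p ] y → u ≡[mod p ] v → (x ℤ.* u) ≡[mod p ] (y ℤ.* v)
  *-cong-mod {x} {y} {u} {v} x≡y u≡v =
    divides-by (x ℤ.* u) (y ℤ.* v)
      (solve 4 (λ x y u v → x :* (u :- v) :+ (x :- y) :* v := x :* u :- y :* v) ≡.refl x y u v)
      (S.∣m∣n⇒∣m+n (S.∣n⇒∣m*n x (signed u v u≡v)) (S.∣m⇒∣m*n v (signed x y x≡y)))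

  neg-cong-mod : ∀ {x y} → x ≡[mod p ] y → (ℤ.- x) ≡[mod p ] (ℤ.- y)
  neg-cong-mod {x} {y} x≡y =
    divides-by (ℤ.- x) (ℤ.- y) (solve 2 (λ x y → :- (x :- y) := (:- x) :- (:- y)) ≡.refl x y)
      (S.∣m⇒∣-m (signed x y x≡y))

  𝔽-isCommutativeRing : IsCommutativeRing _≡[mod p ]_ ℤ._+_ ℤ._*_ ℤ.-_ (+ 0) (+ 1)
  𝔽-isCommutativeRing = record
    { isRing = record
      { +-isAbelianGroup = record
        { isGroup = record
          { isMonoid = record
            { isSemigroup = record
              { isMagma = record
                { isEquivalence = record
                  { refl  = λ {x} → ≡[mod]-reflexive {x} ≡.refl
                  ; sym   = λ {x} {y} → ≡[mod]-sym {x} {y}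
                  ; trans = λ {x} {y} {z} → ≡[mod]-trans {x} {y} {z}
                  }
                ; ∙-cong = λ {x} {y} {u} {v} → +-cong-mod {x} {y} {u} {v}
                }
              ; assoc = λ x y z → ≡[mod]-reflexive (ℤ.+-assoc x y z)
              }
            ; identity = (≡[mod]-reflexive ∘ ℤ.+-identityˡ) , (≡[mod]-reflexive ∘ ℤ.+-identityʳ)
            }
          ; inverse = (≡[mod]-reflexive ∘ ℤ.+-inverseˡ) , (≡[mod]-reflexive ∘ ℤ.+-inverseʳ)
          ; ⁻¹-cong = λ {x} {y} → neg-cong-mod {x} {y}
          }
        ; comm = λ x y → ≡[mod]-reflexive (ℤ.+-comm x y)
        }
      ; *-cong = λ {x} {y} {u} {v} → *-cong-mod {x} {y} {u} {v}
      ; *-assoc = λ x y z → ≡[mod]-reflexive (ℤ.*-assoc x y z)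
      ; *-identity = (≡[mod]-reflexive ∘ ℤ.*-identityˡ) , (≡[mod]-reflexive ∘ ℤ.*-identityʳ)
      ; distrib = (λ x y z → ≡[mod]-reflexive (ℤ.*-distribˡ-+ x y z))
                , (λ x y z → ≡[mod]-reflexive (ℤ.*-distribʳ-+ x y z))
      }
    ; *-comm = λ x y → ≡[mod]-reflexive (ℤ.*-comm x y)
    }

  -- CommutativeRing.rawRing 𝔽-ring is definitionally 𝔽 p.
  𝔽-ring : CommutativeRing 0ℓ 0ℓ
  𝔽-ring = record { isCommutativeRing = 𝔽-isCommutativeRing }

  fromℕ-𝔽 : ∀ m → fromℕ (𝔽 p) m ≡ + m
  fromℕ-𝔽 zero    = ≡.refl
  fromℕ-𝔽 (suc m) = ≡.cong (ℤ._+_ (+ 1)) (fromℕ-𝔽 m)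

  fromℤ-𝔽 : ∀ x → fromℤ (𝔽 p) x ≡ x
  fromℤ-𝔽 (+ m)    = fromℕ-𝔽 m
  fromℤ-𝔽 -[1+ m ] = ≡.cong ℤ.-_ (fromℕ-𝔽 (suc m))

  ReductionSurjective⇒Contains : ∀ {Γ} → ReductionSurjective p Γ → ∀ α β γ δ →
                                 (α ℤ.* δ ℤ.- β ℤ.* γ) ≡[mod p ] (+ 1) → Contains 𝔽-ring Γ ⟦ α , β , γ , δ ⟧
  ReductionSurjective⇒Contains surj α β γ δ det≡1 with surj α β γ δ det≡1
  ... | M , M∈Γ , a≡α , b≡β , c≡γ , d≡δ =
    M , M∈Γ , reduce (a M) α a≡α , reduce (b M) β b≡β , reduce (c M) γ c≡γ , reduce (d M) δ d≡δ
    where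
    reduce : ∀ x y → x ≡[mod p ] y → fromℤ (𝔽 p) x ≡[mod p ] y
    reduce x y = ≡.subst (_≡[mod p ] _) (≡.sym (fromℤ-𝔽 x))

  Unit-mod-prime : ∀ {m} → Prime p → 0 < m → m < p → Unit 𝔽-ring (+ m)
  Unit-mod-prime {m} p-prime 0<m m<p with coprime-Bézout (prime⇒coprime p-prime {{ℕ.>-nonZero 0<m}} m<p)
  ... | Bézout.-+ x y 1+xp≡ym = + y , divides-by (+ m ℤ.* + y) (+ 1) mx-1≡xp (S.divides (+ x) ≡.refl)
    where
    mx-1≡xp : + x ℤ.* + p ≡ + m ℤ.* + y ℤ.- + 1
    mx-1≡xp = ≡.trans (solve 2 (λ X P → X :* P := (con (+ 1) :+ X :* P) :- con (+ 1)) ≡.refl (+ x) (+ p))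
                      (≡.cong (ℤ._- + 1) (≡.trans (toℤ x p y m 1+xp≡ym) (ℤ.*-comm (+ y) (+ m))))
  ... | Bézout.+- x y 1+ym≡xp =
    ℤ.- + y , divides-by (+ m ℤ.* ℤ.- + y) (+ 1) m[-y]-1≡-xp (S.∣m⇒∣-m (S.divides (+ x) ≡.refl))
    where
    m[-y]-1≡-xp : ℤ.- (+ x ℤ.* + p) ≡ + m ℤ.* ℤ.- + y ℤ.- + 1
    m[-y]-1≡-xp = ≡.trans (≡.cong ℤ.-_ (≡.sym (toℤ y m x p 1+ym≡xp)))
                          (solve 2 (λ Y M → :- (con (+ 1) :+ Y :* M) := M :* (:- Y) :- con (+ 1)) ≡.refl (+ y) (+ m))

  odd-prime : Prime p → 2 < p → Σ ℕ λ q → p ≡ suc (q ℕ.* 2)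
  odd-prime p-prime 2<p with p % 2 | m%n<n p 2 | m≡m%n+[m/n]*n p 2
  ... | zero          | _ | p≡[p/2]*2 with prime⇒irreducible p-prime (divides (p / 2) p≡[p/2]*2)
  ...   | inj₁ ()
  ...   | inj₂ 2≡p = ⊥-elim (ℕ.<⇒≢ 2<p 2≡p)
  odd-prime p-prime 2<p | suc zero    | _ | p≡1+[p/2]*2 = p / 2 , p≡1+[p/2]*2
  odd-prime p-prime 2<p | suc (suc _) | s≤s (s≤s ()) | _

-- Principal congruence subgroups

m∣n! : ∀ {m n} → 1 ≤ m → m ≤ n → m ∣ n !
m∣n! {suc m} _ m≤n = ∣-trans (m∣m*n (m !)) (m≤n⇒m!∣n! m≤n)

module _ {r ℓ} (R : CommutativeRing r ℓ) (N : ℕ) where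
  open CommutativeRing R using (rawRing; _*_; refl; +-identityʳ)

  Γ[N]∋upper : Contains R Γ[ N ] (upper R (ι R N))
  Γ[N]∋upper = mat (+ 1) (+ N) (+ 0) (+ 1)
             , (≡.cong (ℤ._-_ (+ 1)) (ℤ.*-zeroʳ (+ N)) , N ∣0 , ∣-refl , N ∣0 , N ∣0)
             , +-identityʳ _ , refl , refl , +-identityʳ _

  Γ[N]∋lower : Contains R Γ[ N ] (lower R (ι R N))
  Γ[N]∋lower = mat (+ 1) (+ 0) (+ N) (+ 1)
             , (≡.refl , N ∣0 , N ∣0 , ∣-refl , N ∣0)
             , +-identityʳ _ , refl , refl , +-identityʳ _

  invariantsVanish-Γ[N] : ∀ n → 1 ≤ n → NotZeroDivisor rawRing (n ! ℕ.* N) →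
                          InvariantsVanish rawRing n Γ[ N ]
  invariantsVanish-Γ[N] n 1≤n n!N-regular =
    invariantsVanish-unipotent R (ι R N) (ι R N) 1≤n Γ[N]∋upper Γ[N]∋lower
                               mN-regular (mN-regular n 1≤n ℕ.≤-refl)
    where
    mN-regular : ∀ m → 1 ≤ m → m ≤ n → Cancellable R (ι R m * ι R N)
    mN-regular m 1≤m m≤n =
      Cancellable-resp-≈ R (ι-* R m N) (Cancellable-ι-∣ R (*-monoˡ-∣ N (m∣n! 1≤m m≤n)) n!N-regular)

  coinvariantsVanish-Γ[N] : ∀ n → 1 ≤ n → Invertible rawRing (n ! ℕ.* N) →
                            CoinvariantsVanish rawRing n Γ[ N ]
  coinvariantsVanish-Γ[N] n 1≤n n!N-unit =
    coinvariantsVanish-unipotent R (ι R N) (ι R N) 1≤n Γ[N]∋upper Γ[N]∋lower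
                                 mN-unit (Unit-ι-∣ R (n∣m*n (n !)) n!N-unit)
    where
    mN-unit : ∀ m → 1 ≤ m → m ≤ n → Unit R (ι R m * ι R N)
    mN-unit m 1≤m m≤n = Unit-resp-≈ R (ι-* R m N) (Unit-ι-∣ R (*-monoˡ-∣ N (m∣n! 1≤m m≤n)) n!N-unit)

-- Reduction modulo a prime

below-or-odd-prime : ∀ {p n} → Prime p → (2 < p → n ≤ p) → (p ≡ 2 → n ≡ 1) → n < p ⊎ (n ≡ p × 2 < p)
below-or-odd-prime {p} p-prime n≤p p≡2⇒n≡1 with p ℕ.≟ 2
... | yes ≡.refl = inj₁ (≡.subst (_< 2) (≡.sym (p≡2⇒n≡1 ≡.refl)) ℕ.≤-refl)
... | no p≢2     = Sum.map₂ (_, 2<p) (ℕ.m≤n⇒m<n∨m≡n (n≤p 2<p))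
  where
  2<p : 2 < p
  2<p = ℕ.≤∧≢⇒< (ℕ.nonTrivial⇒n>1 p {{prime⇒nonTrivial p-prime}}) (p≢2 ∘ ≡.sym)

vanish-below-p : ∀ p n Γ → Prime p → ReductionSurjective p Γ → 1 ≤ n → n < p →
                 InvariantsVanish (𝔽 p) n Γ × CoinvariantsVanish (𝔽 p) n Γ
vanish-below-p p n Γ p-prime surj 1≤n n<p =
    invariantsVanish-unipotent 𝔽p (+ 1) (+ 1) 1≤n U L m-regular (m-regular n 1≤n ℕ.≤-refl)
  , coinvariantsVanish-unipotent 𝔽p (+ 1) (+ 1) 1≤n U L m-unit (+ 1 , ≡[mod]-reflexive p {+ 1} ≡.refl)
  where
  𝔽p : CommutativeRing 0ℓ 0ℓ
  𝔽p = 𝔽-ring p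
  U : Contains 𝔽p Γ (upper 𝔽p (+ 1))
  U = ReductionSurjective⇒Contains p surj (+ 1) (+ 1) (+ 0) (+ 1) (p ∣0)
  L : Contains 𝔽p Γ (lower 𝔽p (+ 1))
  L = ReductionSurjective⇒Contains p surj (+ 1) (+ 0) (+ 1) (+ 1) (p ∣0)
  m-unit : ∀ m → 1 ≤ m → m ≤ n → Unit 𝔽p (fromℕ (𝔽 p) m ℤ.* + 1)
  m-unit m 1≤m m≤n =
    Unit-resp-≈ 𝔽p {+ m} {fromℕ (𝔽 p) m ℤ.* + 1}
      (≡[mod]-reflexive p (≡.sym (≡.trans (ℤ.*-identityʳ _) (fromℕ-𝔽 p m))))
      (Unit-mod-prime p p-prime 1≤m (ℕ.≤-<-trans m≤n n<p))
  m-regular : ∀ m → 1 ≤ m → m ≤ n → Cancellable 𝔽p (fromℕ (𝔽 p) m ℤ.* + 1)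
  m-regular m 1≤m m≤n = Unit⇒Cancellable 𝔽p {fromℕ (𝔽 p) m ℤ.* + 1} (m-unit m 1≤m m≤n)

vanish-at-odd-p : ∀ q Γ → Prime (suc (q ℕ.* 2)) → ReductionSurjective (suc (q ℕ.* 2)) Γ →
                  2 < suc (q ℕ.* 2) →
                  InvariantsVanish (𝔽 (suc (q ℕ.* 2))) (suc (q ℕ.* 2)) Γ
                  × CoinvariantsVanish (𝔽 (suc (q ℕ.* 2))) (suc (q ℕ.* 2)) Γ
vanish-at-odd-p q Γ p-prime surj 2<p =
    invariantsVanish-scalar 𝔽p ℤ.-1ℤ S (Unit⇒Cancellable 𝔽p {ℤ.-1ℤ ^ p ℤ.- + 1} unit)
  , coinvariantsVanish-scalar 𝔽p ℤ.-1ℤ S unit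
  where
  p : ℕ
  p = suc (q ℕ.* 2)
  𝔽p : CommutativeRing 0ℓ 0ℓ
  𝔽p = 𝔽-ring p
  S : Contains 𝔽p Γ (scalar 𝔽p ℤ.-1ℤ)
  S = ReductionSurjective⇒Contains p surj ℤ.-1ℤ (+ 0) (+ 0) ℤ.-1ℤ (p ∣0)
  open import Algebra.Properties.Semiring.Exp (CommutativeRing.semiring 𝔽p) using (_^_)
  unit : Unit 𝔽p (ℤ.-1ℤ ^ p ℤ.- + 1)
  unit = Unit-[-1]^odd-1 𝔽p q (Unit-mod-prime p p-prime (s≤s z≤n) 2<p)

vanish-mod-p : ∀ p n Γ → Prime p → ReductionSurjective p Γ → 1 ≤ n →
               (2 < p → n ≤ p) → (p ≡ 2 → n ≡ 1) →
               InvariantsVanish (𝔽 p) n Γ × CoinvariantsVanish (𝔽 p) n Γ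
vanish-mod-p p n Γ p-prime surj 1≤n n≤p p≡2⇒n≡1 with below-or-odd-prime p-prime n≤p p≡2⇒n≡1
... | inj₁ n<p = vanish-below-p p n Γ p-prime surj 1≤n n<p
... | inj₂ (≡.refl , 2<p) with odd-prime p p-prime 2<p
...   | q , ≡.refl = vanish-at-odd-p q Γ p-prime surj 2<p

open import Data.Nat using (_*_)

proposition2p5 : {c ℓ : Level} →
    ((R : CommutativeRing c ℓ) (n N : ℕ) → 1 ≤ n → 1 ≤ N →
      NotZeroDivisor (CommutativeRing.rawRing R) ((n !) * N) →
      InvariantsVanish (CommutativeRing.rawRing R) n Γ[ N ])
    × ((R : CommutativeRing c ℓ) (n N : ℕ) → 1 ≤ n → 1 ≤ N →
      Invertible (CommutativeRing.rawRing R) ((n !) * N) →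
      CoinvariantsVanish (CommutativeRing.rawRing R) n Γ[ N ])
    × ((p n : ℕ) (Γ : Mat2 → Set) → Prime p → IsSubgroupSL2 Γ →
      ReductionSurjective p Γ → 1 ≤ n → (2 < p → n ≤ p) → (p ≡ 2 → n ≡ 1) →
      InvariantsVanish (𝔽 p) n Γ × CoinvariantsVanish (𝔽 p) n Γ)
proposition2p5 =
    (λ R n N 1≤n _ → invariantsVanish-Γ[N] R N n 1≤n)
  , (λ R n N 1≤n _ → coinvariantsVanish-Γ[N] R N n 1≤n)
  , (λ p n Γ p-prime _ → vanish-mod-p p n Γ p-prime)
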